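{- Let $L=(V,E)$ be a clutter such that (C1) no vertex of $V$ belongs to all edges of $L$, and (C2) every vertex of $V$ belongs to at least one edge of $L$. Then \[c(L)\geq \frac{1}{|V|-2\sqrt{|V|}+2}.\]
   Context: A clutter $L=(V,E)$ consists of a finite set $V$ (vertices) and a family $E$ of subsets of $V$ (edges) none of which is a subset of another. For an edge $e\in E$, a subset $e_0\subseteq e$ is a recognizing subset for $e$ if the only edge $e'\in E$ with $e_0\subseteq e'$ is $e'=e$. Letting $s_e$ be a smallest recognizing subset of $e$, define $c(e)=|s_e|/|e|$ and the hardness $c(L)=\max_{e\in E} c(e)$. -}

module Defs where

open import Data.Nat using (ℕ; _+_; _*_; _∸_; _≤_; _^_)
open import Data.Fin using (Fin)
open import Data.Fin.Subset using (Subset; _⊆_; ∣_∣) renaming (_∈_ to _∈ˢ_)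
open import Data.List using (List)
open import Data.List.Membership.Propositional using () renaming (_∈_ to _∈ᴸ_)
open import Data.Product using (_×_; ∃; Σ-syntax)
open import Relation.Nullary using (¬_)
open import Relation.Binary.PropositionalEquality using (_≡_)

-- A hypergraph on the vertex set V = Fin n (so |V| = n); the edge family E
-- is given as a list of subsets of V (read as a set: repetitions irrelevant).
Edges : ℕ → Set
Edges n = List (Subset n)

IsClutter : ∀ {n} → Edges n → Set
IsClutter E = ∀ {e e′} → e ∈ᴸ E → e′ ∈ᴸ E → e ⊆ e′ → e ≡ e′

NoVertexInAllEdges : ∀ {n} → Edges n → Set
NoVertexInAllEdges {n} E = (v : Fin n) → ¬ (∀ e → e ∈ᴸ E → v ∈ˢ e)

EveryVertexCovered : ∀ {n} → Edges n → Set
EveryVertexCovered {n} E = (v : Fin n) → ∃ λ e → e ∈ᴸ E × v ∈ˢ e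

IsRecognizing : ∀ {n} → Edges n → Subset n → Subset n → Set
IsRecognizing E e s = s ⊆ e × (∀ e′ → e′ ∈ᴸ E → s ⊆ e′ → e′ ≡ e)

IsSmallestRecognizing : ∀ {n} → Edges n → Subset n → Subset n → Set
IsSmallestRecognizing E e s =
  IsRecognizing E e s × (∀ t → IsRecognizing E e t → ∣ s ∣ ≤ ∣ t ∣)

-- RatioAtLeastBound N k m  expresses, without real numbers, the inequality
--     k / m  ≥  1 / (N - 2√N + 2)          (for m > 0),
-- Since N - 2√N + 2 = (√N - 1)² + 1 > 0 and k/m ≥ 0, this is equivalent to
--     k(N+2) - m ≥ 2k√N,
-- i.e. to  k(N+2) ≥ m  and  (k(N+2) - m)² ≥ 4k²N.
RatioAtLeastBound : ℕ → ℕ → ℕ → Set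
RatioAtLeastBound N k m =
  m ≤ k * (N + 2) × 4 * (k * k) * N ≤ (k * (N + 2) ∸ m) ^ 2

-- c(L) ≥ 1/(N - 2√N + 2), where c(L) = max_{e ∈ E} |s_e|/|e|:
-- some edge e with a smallest recognizing subset s_e has |s_e|/|e| above
-- the bound (all smallest recognizing subsets of e have the same size).
HardnessAtLeastBound : ∀ {n} → Edges n → Set
HardnessAtLeastBound {n} E =
  Σ[ e ∈ Subset n ] Σ[ s ∈ Subset n ]
    (e ∈ᴸ E × IsSmallestRecognizing E e s × RatioAtLeastBound n ∣ s ∣ ∣ e ∣)

-- A recognizing subset is never empty, by (C1) and (C2). So if some edge has no
-- private vertex (one lying in no other edge), its recognizing subsets have at
-- least two vertices and c(L) ≥ 2/|V|, enough since |V| - 2√|V| + 2 ≥ |V|/2.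
-- Otherwise {w} recognizes e for a private vertex w of each edge e, and it remains
-- to bound the least edge size m. Among the r ≥ 2 edges every vertex has degree
-- at most r - 1, so double counting with weight 1 + (r - 2)·[degree one] gives
-- r (m + r - 2) ≤ |V| (r - 1), i.e. m ≤ |V| + 2 - |V|/r - r ≤ |V| + 2 - 2√|V|.
module Submission where

open import Defs
open import Data.Nat using (ℕ; _≤_)

open import Data.Bool using (true; false; if_then_else_)
import Data.Bool.Properties as Bool
open import Data.Fin using (Fin; zero; suc; punchIn)
open import Data.Fin.Properties using (any?; punchInᵢ≢i) renaming (_≟_ to _≟ᶠ_)
open import Data.Fin.Subset using (Subset; _⊆_; _∈_; _∉_; ∣_∣; ⁅_⁆; Nonempty)
open import Data.Fin.Subset.Properties
  using (_⊆?_; _∈?_; nonempty?; anySubset?; ∣p∣≤n; x∈⁅x⁆; x∈⁅y⁆⇒x≡y; ∣⁅x⁆∣≡1;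
         x∈p⇒∣p-x∣<∣p∣; x∈p∧x≢y⇒x∈p-y)
open import Data.List as List using (List; _∷_; length; deduplicate)
import Data.List.Membership.DecPropositional
open import Data.List.Membership.Propositional using (find) renaming (_∈_ to _∈ᴸ_)
open import Data.List.Membership.Propositional.Properties using (∈-lookup; ∈-deduplicate⁺; ∈-deduplicate⁻)
import Data.List.Relation.Unary.All as All
open import Data.List.Relation.Unary.All.Properties.Core using (¬All⇒Any¬)
open import Data.List.Relation.Unary.AllPairs using (_∷_)
open import Data.List.Relation.Unary.Any using (index)
open import Data.List.Relation.Unary.Any.Properties using (lookup-index)
open import Data.List.Relation.Unary.Unique.Propositional using (Unique)
open import Data.List.Relation.Unary.Unique.DecPropositional.Properties using (deduplicate-!)
open import Data.Nat using (zero; suc; _+_; _*_; _∸_; _<_; _^_; z≤n; s≤s; NonZero)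
open import Data.Nat.Properties
open import Data.Nat.Tactic.RingSolver using (solve)
open import Data.Product using (_×_; _,_; proj₁; proj₂; ∃-syntax)
open import Data.Sum using (_⊎_; inj₁; inj₂)
import Data.Vec as Vec
open import Data.Vec.Properties using ([]=⇒lookup; lookup⇒[]=; ≡-dec)
open import Function using (_∘_)
open import Relation.Binary.Definitions using (DecidableEquality)
open import Relation.Binary.PropositionalEquality
open import Relation.Nullary using (¬_; Dec; yes; no; contradiction)
open import Relation.Nullary.Decidable using (_×-dec_; _→-dec_)
open import Relation.Unary using (Decidable)

open import Algebra.Properties.Semiring.Sum +-*-semiring
  using (sum-syntax; sum-remove; sum-cong-≗; ∑-distrib-+; ∑-comm; *-distribˡ-sum; *-distribʳ-sum)

∑-mono-≤ : ∀ {n} {f g : Fin n → ℕ} → (∀ i → f i ≤ g i) → ∑[ i < n ] f i ≤ ∑[ i < n ] g i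
∑-mono-≤ {zero}  f≤g = z≤n
∑-mono-≤ {suc n} f≤g = +-mono-≤ (f≤g zero) (∑-mono-≤ (f≤g ∘ suc))

∑-const : ∀ n c → ∑[ i < n ] c ≡ n * c
∑-const zero    c = refl
∑-const (suc n) c = cong (c +_) (∑-const n c)

term≤∑ : ∀ {n} (f : Fin n → ℕ) i → f i ≤ ∑[ j < n ] f j
term≤∑ {suc n} f i = subst (f i ≤_) (sym (sum-remove {i = i} f)) (m≤m+n (f i) _)

∑-single : ∀ {n} (f : Fin n → ℕ) i → (∀ j → j ≢ i → f j ≡ 0) → ∑[ j < n ] f j ≡ f i
∑-single {suc n} f i f≡0 = begin
  ∑[ j < suc n ] f j               ≡⟨ sum-remove {i = i} f ⟩
  f i + ∑[ j < n ] f (punchIn i j) ≡⟨ cong (f i +_) (sum-cong-≗ (λ j → f≡0 _ (punchInᵢ≢i i j))) ⟩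
  f i + ∑[ j < n ] 0               ≡⟨ cong (f i +_) (trans (∑-const n 0) (*-zeroʳ n)) ⟩
  f i + 0                          ≡⟨ +-identityʳ (f i) ⟩
  f i                              ∎
  where open ≡-Reasoning

∑-<-length : ∀ {n} (f : Fin n → ℕ) i → (∀ j → f j ≤ 1) → f i ≡ 0 → ∑[ j < n ] f j < n
∑-<-length {suc n} f i f≤1 fi≡0 = begin-strict
  ∑[ j < suc n ] f j               ≡⟨ sum-remove {i = i} f ⟩
  f i + ∑[ j < n ] f (punchIn i j) ≡⟨ cong (_+ ∑[ j < n ] f (punchIn i j)) fi≡0 ⟩
  ∑[ j < n ] f (punchIn i j)       ≤⟨ ∑-mono-≤ (f≤1 ∘ punchIn i) ⟩
  ∑[ j < n ] 1                     ≡⟨ trans (∑-const n 1) (*-identityʳ n) ⟩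
  n                                <⟨ n<1+n n ⟩
  suc n                            ∎
  where open ≤-Reasoning

𝟙[_∈_] : ∀ {n} → Fin n → Subset n → ℕ
𝟙[ v ∈ p ] = if Vec.lookup p v then 1 else 0

𝟙-∈ : ∀ {n} {v : Fin n} {p} → v ∈ p → 𝟙[ v ∈ p ] ≡ 1
𝟙-∈ v∈p rewrite []=⇒lookup v∈p = refl

𝟙-∉ : ∀ {n} {v : Fin n} {p} → v ∉ p → 𝟙[ v ∈ p ] ≡ 0
𝟙-∉ {v = v} {p} v∉p with Vec.lookup p v in eq
... | true  = contradiction (lookup⇒[]= v p eq) v∉p
... | false = refl

𝟙≤1 : ∀ {n} (v : Fin n) p → 𝟙[ v ∈ p ] ≤ 1
𝟙≤1 v p with Vec.lookup p v
... | true  = ≤-refl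
... | false = z≤n

∣p∣≡∑𝟙 : ∀ {n} (p : Subset n) → ∣ p ∣ ≡ ∑[ v < n ] 𝟙[ v ∈ p ]
∣p∣≡∑𝟙 Vec.[]          = refl
∣p∣≡∑𝟙 (true  Vec.∷ p) = cong suc (∣p∣≡∑𝟙 p)
∣p∣≡∑𝟙 (false Vec.∷ p) = ∣p∣≡∑𝟙 p

𝟙[_≡1] : ℕ → ℕ
𝟙[ 1 ≡1] = 1
𝟙[ _ ≡1] = 0

_≟ˢ_ : ∀ {n} → DecidableEquality (Subset n)
_≟ˢ_ = ≡-dec Bool._≟_

x∈p⇒0<∣p∣ : ∀ {n} {x : Fin n} {p} → x ∈ p → 0 < ∣ p ∣
x∈p⇒0<∣p∣ x∈p = ≤-trans (s≤s z≤n) (x∈p⇒∣p-x∣<∣p∣ x∈p)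

x∈p⇒⁅x⁆⊆p : ∀ {n} {x : Fin n} {p} → x ∈ p → ⁅ x ⁆ ⊆ p
x∈p⇒⁅x⁆⊆p {x = x} x∈p y∈⁅x⁆ = subst (_∈ _) (sym (x∈⁅y⁆⇒x≡y x y∈⁅x⁆)) x∈p

x∈p∧∣p∣≤1⇒p⊆⁅x⁆ : ∀ {n} {x : Fin n} {p} → x ∈ p → ∣ p ∣ ≤ 1 → p ⊆ ⁅ x ⁆
x∈p∧∣p∣≤1⇒p⊆⁅x⁆ {x = x} {p} x∈p ∣p∣≤1 {y} y∈p with y ≟ᶠ x
... | yes refl = x∈⁅x⁆ x
... | no y≢x   = contradiction (≤-trans 1<∣p∣ ∣p∣≤1) (λ { (s≤s ()) })
  where
  1<∣p∣ : 1 < ∣ p ∣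
  1<∣p∣ = ≤-trans (s≤s (x∈p⇒0<∣p∣ (x∈p∧x≢y⇒x∈p-y y∈p y≢x))) (x∈p⇒∣p-x∣<∣p∣ x∈p)

smallest : ∀ {n} {P : Subset n → Set} → Decidable P → ∀ {s} → P s →
           ∃[ t ] (P t × ∀ u → P u → ∣ t ∣ ≤ ∣ u ∣)
smallest {P = P} P? {s} Ps = search ∣ s ∣ Ps ≤-refl
  where
  search : ∀ bound {s} → P s → ∣ s ∣ ≤ bound → ∃[ t ] (P t × ∀ u → P u → ∣ t ∣ ≤ ∣ u ∣)
  search zero    {s} Ps ∣s∣≤0 = s , Ps , λ u _ → ≤-trans ∣s∣≤0 z≤n
  search (suc b) {s} Ps ∣s∣≤ with anySubset? (λ u → P? u ×-dec (∣ u ∣ <? ∣ s ∣))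
  ... | yes (u , Pu , ∣u∣<∣s∣) = search b Pu (≤-pred (≤-trans ∣u∣<∣s∣ ∣s∣≤))
  ... | no ¬smaller           = s , Ps , λ u Pu → ≮⇒≥ (λ ∣u∣<∣s∣ → ¬smaller (u , Pu , ∣u∣<∣s∣))

∀∈⊎∃∈¬ : ∀ {A : Set} {P : A → Set} → Decidable P → (xs : List A) →
         (∀ x → x ∈ᴸ xs → P x) ⊎ ∃[ x ] (x ∈ᴸ xs × ¬ P x)
∀∈⊎∃∈¬ P? xs with All.all? P? xs
... | yes all = inj₁ (λ _ → All.lookup all)
... | no ¬all = inj₂ (find (¬All⇒Any¬ P? xs ¬all))

∀∈? : ∀ {A : Set} {P : A → Set} → Decidable P → (xs : List A) → Dec (∀ x → x ∈ᴸ xs → P x)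
∀∈? P? xs with ∀∈⊎∃∈¬ P? xs
... | inj₁ all              = yes all
... | inj₂ (x , x∈xs , ¬Px) = no (λ all → ¬Px (all x x∈xs))

lookup-injective : ∀ {A : Set} {xs : List A} → Unique xs →
                   ∀ {i j} → List.lookup xs i ≡ List.lookup xs j → i ≡ j
lookup-injective {xs = _ ∷ _} (_ ∷ _)    {zero}  {zero}  _  = refl
lookup-injective {xs = _ ∷ _} (x∉ ∷ _)   {zero}  {suc j} eq = contradiction eq (All.lookup x∉ (∈-lookup j))
lookup-injective {xs = _ ∷ _} (x∉ ∷ _)   {suc i} {zero}  eq = contradiction (sym eq) (All.lookup x∉ (∈-lookup i))
lookup-injective {xs = _ ∷ _} (_ ∷ uniq) {suc i} {suc j} eq = cong suc (lookup-injective uniq eq)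

4*[m*n]≤[m+n]²-of-≤ : ∀ {m n} → m ≤ n → 4 * (m * n) ≤ (m + n) * (m + n)
4*[m*n]≤[m+n]²-of-≤ {m} m≤n with m≤n⇒∃[o]m+o≡n m≤n
... | d , refl = begin
  4 * (m * (m + d))             ≤⟨ m≤m+n _ (d * d) ⟩
  4 * (m * (m + d)) + d * d     ≡⟨ solve (m ∷ d ∷ List.[]) ⟩
  (m + (m + d)) * (m + (m + d)) ∎
  where open ≤-Reasoning

4*[m*n]≤[m+n]² : ∀ m n → 4 * (m * n) ≤ (m + n) * (m + n)
4*[m*n]≤[m+n]² m n with ≤-total m n
... | inj₁ m≤n = 4*[m*n]≤[m+n]²-of-≤ m≤n
... | inj₂ n≤m = subst₂ _≤_ (cong (4 *_) (*-comm n m)) (cong₂ _*_ (+-comm n m) (+-comm n m))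
                   (4*[m*n]≤[m+n]²-of-≤ n≤m)

-- N + R² ≥ 2R√N for every R, so the hypothesis gives k (N + 2) - m ≥ k (N + R²) / R ≥ 2k√N.
RatioAtLeastBound-intro : ∀ {N k m} R .{{_ : NonZero R}} →
                          k * (N + R * R) + R * m ≤ R * (k * (N + 2)) → RatioAtLeastBound N k m
RatioAtLeastBound-intro {N} {k} {m} R h = m≤k[N+2] , *-cancelˡ-≤ (R * R) {{m*n≢0 R R}} (begin
  R * R * (4 * (k * k) * N)           ≡⟨ solve (R ∷ k ∷ N ∷ List.[]) ⟩
  k * k * (4 * (N * (R * R)))         ≤⟨ *-monoʳ-≤ (k * k) (4*[m*n]≤[m+n]² N (R * R)) ⟩
  k * k * ((N + R * R) * (N + R * R)) ≡⟨ solve (R ∷ k ∷ N ∷ List.[]) ⟩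
  k * (N + R * R) * (k * (N + R * R)) ≤⟨ *-mono-≤ k[N+R²]≤R*d k[N+R²]≤R*d ⟩
  R * d * (R * d)                     ≡⟨ [m*n]*[o*p]≡[m*o]*[n*p] R d R d ⟩
  R * R * (d * d)                     ≡⟨ cong (R * R *_) (cong (d *_) (sym (*-identityʳ d))) ⟩
  R * R * d ^ 2                       ∎)
  where
  open ≤-Reasoning

  m≤k[N+2] : m ≤ k * (N + 2)
  m≤k[N+2] = *-cancelˡ-≤ R (≤-trans (m≤n+m (R * m) _) h)

  d : ℕ
  d = k * (N + 2) ∸ m

  k[N+R²]≤R*d : k * (N + R * R) ≤ R * d
  k[N+R²]≤R*d = subst (k * (N + R * R) ≤_) (sym (*-distribˡ-∸ R (k * (N + 2)) m))
                  (m+n≤o⇒m≤o∸n (k * (N + R * R)) h)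

2≤k⇒RatioAtLeastBound : ∀ {N k m} → 2 ≤ k → m ≤ N → RatioAtLeastBound N k m
2≤k⇒RatioAtLeastBound {N} {suc (suc j)} {m} (s≤s (s≤s z≤n)) m≤N =
  RatioAtLeastBound-intro {N} {2 + j} {m} 2 (begin
    (2 + j) * (N + 2 * 2) + 2 * m         ≤⟨ +-monoʳ-≤ ((2 + j) * (N + 2 * 2)) (*-monoʳ-≤ 2 m≤N) ⟩
    (2 + j) * (N + 2 * 2) + 2 * N         ≤⟨ m≤m+n _ (j * N) ⟩
    (2 + j) * (N + 2 * 2) + 2 * N + j * N ≡⟨ solve (j ∷ N ∷ List.[]) ⟩
    2 * ((2 + j) * (N + 2))               ∎)
  where open ≤-Reasoning

edge-count⇒RatioAtLeastBound : ∀ N q m → (2 + q) * (m + q) ≤ N * suc q → RatioAtLeastBound N 1 m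
edge-count⇒RatioAtLeastBound N q m h = RatioAtLeastBound-intro {N} {1} {m} (2 + q)
  (+-cancelʳ-≤ ((2 + q) * q) _ _ (begin
    1 * (N + (2 + q) * (2 + q)) + (2 + q) * m + (2 + q) * q ≡⟨ solve (q ∷ N ∷ m ∷ List.[]) ⟩
    N + (2 + q) * (2 + q) + (2 + q) * (m + q)             ≤⟨ +-monoʳ-≤ (N + (2 + q) * (2 + q)) h ⟩
    N + (2 + q) * (2 + q) + N * suc q                     ≡⟨ solve (q ∷ N ∷ List.[]) ⟩
    (2 + q) * (1 * (N + 2)) + (2 + q) * q                 ∎))
  where open ≤-Reasoning

module Degrees {n r} (es : Fin r → Subset n) where

  degree : Fin n → ℕ
  degree v = ∑[ i < r ] 𝟙[ v ∈ es i ]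

  degree-pos : ∀ {v i} → v ∈ es i → 0 < degree v
  degree-pos {v} {i} v∈esᵢ = subst (_≤ degree v) (𝟙-∈ v∈esᵢ) (term≤∑ (λ j → 𝟙[ v ∈ es j ]) i)

  degree<r : ∀ {v i} → v ∉ es i → degree v < r
  degree<r {v} {i} v∉esᵢ = ∑-<-length (λ j → 𝟙[ v ∈ es j ]) i (λ j → 𝟙≤1 v (es j)) (𝟙-∉ v∉esᵢ)

  degree≡1 : ∀ {v i} → v ∈ es i → (∀ j → v ∈ es j → j ≡ i) → degree v ≡ 1
  degree≡1 {v} {i} v∈esᵢ only-i =
    trans (∑-single (λ j → 𝟙[ v ∈ es j ]) i (λ j j≢i → 𝟙-∉ (j≢i ∘ only-i j))) (𝟙-∈ v∈esᵢ)

  ∑∑𝟙*w≡∑degree*w : (w : Fin n → ℕ) →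
                    ∑[ i < r ] ∑[ v < n ] (𝟙[ v ∈ es i ] * w v) ≡ ∑[ v < n ] (degree v * w v)
  ∑∑𝟙*w≡∑degree*w w = trans (∑-comm (λ i v → 𝟙[ v ∈ es i ] * w v))
    (sum-cong-≗ (λ v → sym (*-distribʳ-sum (w v) (λ i → 𝟙[ v ∈ es i ]))))

  -- Weigh each vertex by 1, plus q if it has degree one: every edge then weighs
  -- at least m + q, while every vertex contributes at most q + 1 in total.
  edge-count-bound : ∀ q m → (∀ v → degree v ≤ suc q) → (∀ i → m ≤ ∣ es i ∣) →
                     (∀ i → ∃[ v ] (v ∈ es i × degree v ≡ 1)) → r * (m + q) ≤ n * suc q
  edge-count-bound q m degree≤1+q m≤∣esᵢ∣ degree-one-vertex = begin
    r * (m + q)                                  ≡⟨ ∑-const r (m + q) ⟨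
    ∑[ i < r ] (m + q)                           ≤⟨ ∑-mono-≤ edge-weight ⟩
    ∑[ i < r ] ∑[ v < n ] (𝟙[ v ∈ es i ] * w v) ≡⟨ ∑∑𝟙*w≡∑degree*w w ⟩
    ∑[ v < n ] (degree v * w v)                  ≤⟨ ∑-mono-≤ (λ v → vertex-weight (degree v) (degree≤1+q v)) ⟩
    ∑[ v < n ] suc q                             ≡⟨ ∑-const n (suc q) ⟩
    n * suc q                                    ∎
    where
    open ≤-Reasoning

    w : Fin n → ℕ
    w v = 1 + q * 𝟙[ degree v ≡1]

    vertex-weight : ∀ d → d ≤ suc q → d * (1 + q * 𝟙[ d ≡1]) ≤ suc q
    vertex-weight zero          _     = z≤n
    vertex-weight 1             _     = ≤-reflexive (solve (q ∷ List.[]))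
    vertex-weight (suc (suc d)) d≤1+q = begin
      suc (suc d) * (1 + q * 0) ≡⟨ solve (d ∷ q ∷ List.[]) ⟩
      suc (suc d)               ≤⟨ d≤1+q ⟩
      suc q                     ∎

    edge-weight : ∀ i → m + q ≤ ∑[ v < n ] (𝟙[ v ∈ es i ] * w v)
    edge-weight i with degree-one-vertex i
    ... | u , u∈esᵢ , degree-u≡1 = begin
      m + q                                   ≡⟨ cong (m +_) (*-identityʳ q) ⟨
      m + q * 1                               ≤⟨ +-mono-≤ (m≤∣esᵢ∣ i) (*-monoʳ-≤ q 0<∑𝟙¹) ⟩
      ∣ es i ∣ + q * ∑[ v < n ] 𝟙¹ v          ≡⟨ cong₂ _+_ (∣p∣≡∑𝟙 (es i)) (*-distribˡ-sum q 𝟙¹) ⟩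
      ∑[ v < n ] 𝟙ᵢ v + ∑[ v < n ] (q * 𝟙¹ v) ≡⟨ ∑-distrib-+ 𝟙ᵢ (λ v → q * 𝟙¹ v) ⟨
      ∑[ v < n ] (𝟙ᵢ v + q * 𝟙¹ v)            ≡⟨ sum-cong-≗ (λ v → distrib (𝟙ᵢ v) (𝟙[ degree v ≡1])) ⟨
      ∑[ v < n ] (𝟙ᵢ v * w v)                 ∎
      where
      𝟙ᵢ 𝟙¹ : Fin n → ℕ
      𝟙ᵢ v = 𝟙[ v ∈ es i ]
      𝟙¹ v = 𝟙ᵢ v * 𝟙[ degree v ≡1]

      distrib : ∀ a b → a * (1 + q * b) ≡ a + q * (a * b)
      distrib a b = solve (a ∷ b ∷ q ∷ List.[])

      0<∑𝟙¹ : 0 < ∑[ v < n ] 𝟙¹ v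
      0<∑𝟙¹ = subst (_≤ ∑[ v < n ] 𝟙¹ v) (cong₂ _*_ (𝟙-∈ u∈esᵢ) (cong 𝟙[_≡1] degree-u≡1)) (term≤∑ 𝟙¹ u)

module Recognizing {n} (E : Edges n) where

  isRecognizing? : ∀ e s → Dec (IsRecognizing E e s)
  isRecognizing? e s = (s ⊆? e) ×-dec ∀∈? (λ e′ → (s ⊆? e′) →-dec (e′ ≟ˢ e)) E

  recognizing-⊆ : ∀ {e s t} → IsRecognizing E e s → s ⊆ t → t ⊆ e → IsRecognizing E e t
  recognizing-⊆ (_ , only-e) s⊆t t⊆e = t⊆e , λ e′ e′∈E t⊆e′ → only-e e′ e′∈E (t⊆e′ ∘ s⊆t)

  edge-recognizes-itself : IsClutter E → ∀ {e} → e ∈ᴸ E → IsRecognizing E e e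
  edge-recognizes-itself clutter e∈E = (λ x∈e → x∈e) , λ e′ e′∈E e⊆e′ → sym (clutter e∈E e′∈E e⊆e′)

  -- v lies in e and in no other edge exactly when ⁅ v ⁆ recognizes e.
  HasPrivateVertex : Subset n → Set
  HasPrivateVertex e = ∃[ v ] IsRecognizing E e ⁅ v ⁆

  hasPrivateVertex? : ∀ e → Dec (HasPrivateVertex e)
  hasPrivateVertex? e = any? (λ v → isRecognizing? e ⁅ v ⁆)

module _ {n} {E : Edges (suc n)} (clutter : IsClutter E)
         (c1 : NoVertexInAllEdges E) (c2 : EveryVertexCovered E) where

  open Recognizing E

  uncovering-edge : ∀ v → ∃[ e ] (e ∈ᴸ E × v ∉ e)
  uncovering-edge v with ∀∈⊎∃∈¬ (v ∈?_) E
  ... | inj₁ v∈all = contradiction v∈all (c1 v)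
  ... | inj₂ e     = e

  -- If s were empty, every edge would equal e, so a vertex covered by (C2) lies in all edges.
  recognizing-nonempty : ∀ {e s} → IsRecognizing E e s → Nonempty s
  recognizing-nonempty {e} {s} (_ , only-e) with nonempty? s
  ... | yes s≠∅ = s≠∅
  ... | no  s=∅ with c2 zero
  ...   | e₀ , e₀∈E , 0∈e₀ =
    contradiction (λ e′ e′∈E → subst (zero ∈_) (trans (≡e e₀∈E) (sym (≡e e′∈E))) 0∈e₀) (c1 zero)
    where
    ≡e : ∀ {e′} → e′ ∈ᴸ E → e′ ≡ e
    ≡e e′∈E = only-e _ e′∈E (λ x∈s → contradiction (_ , x∈s) s=∅)

  singleton-recognizing⇒smallest : ∀ {e w} → IsRecognizing E e ⁅ w ⁆ → IsSmallestRecognizing E e ⁅ w ⁆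
  singleton-recognizing⇒smallest {w = w} ⁅w⁆-rec = ⁅w⁆-rec , λ t t-rec →
    subst (_≤ ∣ t ∣) (sym (∣⁅x⁆∣≡1 w)) (x∈p⇒0<∣p∣ (proj₂ (recognizing-nonempty t-rec)))

  no-private-vertex⇒2≤∣s∣ : ∀ {e s} → ¬ HasPrivateVertex e → IsRecognizing E e s → 2 ≤ ∣ s ∣
  no-private-vertex⇒2≤∣s∣ {s = s} ¬private s-rec@(s⊆e , _) with recognizing-nonempty s-rec | 2 ≤? ∣ s ∣
  ... | _ , _   | yes 2≤∣s∣ = 2≤∣s∣
  ... | x , x∈s | no  2≰∣s∣ = contradiction
    (x , recognizing-⊆ s-rec (x∈p∧∣p∣≤1⇒p⊆⁅x⁆ x∈s (≤-pred (≰⇒> 2≰∣s∣))) (x∈p⇒⁅x⁆⊆p (s⊆e x∈s)))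
    ¬private

  private-vertices⇒RatioAtLeastBound : (∀ e → e ∈ᴸ E → HasPrivateVertex e) →
                                       ∀ {m} → (∀ e → e ∈ᴸ E → m ≤ ∣ e ∣) → RatioAtLeastBound (suc n) 1 m
  private-vertices⇒RatioAtLeastBound private-vertex {m} m≤∣e∣ = edge-count⇒RatioAtLeastBound (suc n) q m
    (subst (λ r → r * (m + q) ≤ suc n * suc q) r≡2+q
      (edge-count-bound q m degree≤1+q (λ i → m≤∣e∣ (es i) (es∈E i)) degree-one-vertex))
    where
    D : Edges (suc n)
    D = deduplicate _≟ˢ_ E

    es : Fin (length D) → Subset (suc n)
    es = List.lookup D

    open Degrees es

    es∈E : ∀ i → es i ∈ᴸ E
    es∈E i = ∈-deduplicate⁻ _≟ˢ_ E (∈-lookup i)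

    index-of : ∀ {e} → e ∈ᴸ E → ∃[ i ] (e ≡ es i)
    index-of e∈E = let e∈D = ∈-deduplicate⁺ _≟ˢ_ e∈E in index e∈D , lookup-index e∈D

    degree<length : ∀ v → degree v < length D
    degree<length v with uncovering-edge v
    ... | e , e∈E , v∉e with index-of e∈E
    ...   | i , refl = degree<r v∉e

    2≤length : 2 ≤ length D
    2≤length with c2 zero
    ... | e , e∈E , 0∈e with index-of e∈E
    ...   | i , refl = ≤-trans (s≤s (degree-pos 0∈e)) (degree<length zero)

    q : ℕ
    q = length D ∸ 2

    r≡2+q : length D ≡ 2 + q
    r≡2+q = trans (sym (m∸n+n≡m 2≤length)) (+-comm q 2)

    degree≤1+q : ∀ v → degree v ≤ suc q
    degree≤1+q v = ≤-pred (subst (degree v <_) r≡2+q (degree<length v))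

    degree-one-vertex : ∀ i → ∃[ v ] (v ∈ es i × degree v ≡ 1)
    degree-one-vertex i with private-vertex (es i) (es∈E i)
    ... | v , ⁅v⁆⊆esᵢ , only-esᵢ = v , v∈esᵢ , degree≡1 v∈esᵢ
      (λ j v∈esⱼ → lookup-injective (deduplicate-! _≟ˢ_ E) (only-esᵢ (es j) (es∈E j) (x∈p⇒⁅x⁆⊆p v∈esⱼ)))
      where
      v∈esᵢ : v ∈ es i
      v∈esᵢ = ⁅v⁆⊆esᵢ (x∈⁅x⁆ v)

  hardness-without-private-vertex : ∀ {e} → e ∈ᴸ E → ¬ HasPrivateVertex e → HardnessAtLeastBound E
  hardness-without-private-vertex {e} e∈E ¬private =
    let s , s-smallest = smallest (isRecognizing? e) (edge-recognizes-itself clutter e∈E)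
    in  e , s , e∈E , s-smallest ,
        2≤k⇒RatioAtLeastBound (no-private-vertex⇒2≤∣s∣ ¬private (proj₁ s-smallest)) (∣p∣≤n e)

  hardness-with-private-vertices : (∀ e → e ∈ᴸ E → HasPrivateVertex e) → HardnessAtLeastBound E
  hardness-with-private-vertices private-vertex =
    let e , e∈E , e-smallest = smallest (_∈ᴸ? E) (proj₁ (proj₂ (c2 zero)))
        w , ⁅w⁆-rec          = private-vertex e e∈E
    in  e , ⁅ w ⁆ , e∈E , singleton-recognizing⇒smallest ⁅w⁆-rec ,
        subst (λ k → RatioAtLeastBound (suc n) k ∣ e ∣) (sym (∣⁅x⁆∣≡1 w))
          (private-vertices⇒RatioAtLeastBound private-vertex e-smallest)
    where open Data.List.Membership.DecPropositional (_≟ˢ_ {suc n}) using () renaming (_∈?_ to _∈ᴸ?_)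

theorem1 : (n : ℕ) → 1 ≤ n → (E : Edges n) → IsClutter E →
           NoVertexInAllEdges E → EveryVertexCovered E →
           HardnessAtLeastBound E
theorem1 (suc n) _ E clutter c1 c2 with ∀∈⊎∃∈¬ (Recognizing.hasPrivateVertex? E) E
... | inj₁ private-vertex       = hardness-with-private-vertices clutter c1 c2 private-vertex
... | inj₂ (e , e∈E , ¬private) = hardness-without-private-vertex clutter c1 c2 e∈E ¬private
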